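{- Let $k\ge 1$, let $b=(B_{ -(k-1)},\dots,B_0)$ be $k$ open bins that may already contain items, and let $P=(B_1,\dots,B_x)$ be a packing of a set $S$ of items into $x$ unit bins. Let $P'$ be the packing produced by running Bounded Best-Fit with $k$ open bins on the items of $S$, presented in the order in which they appear in $P$ (all items of $B_1$, then all items of $B_2$, and so on), starting with the bins of $b$ as the initially open bins. Then the number of bins used by $P'$ (including the bins of $b$) is at most $k+x$.
   Context: Bounded Best-Fit (BBF) with parameter $k$ is the following online bin packing algorithm with unit-capacity bins: at any time at most $k$ bins are open; all other used bins are closed and can never be reopened. An arriving item of size $s$ is packed into the fullest open bin that has room for it (ties broken arbitrarily). If no open bin has room, the fullest open bin is closed and a new empty bin is opened, into which the item is packed.
   Formalization: Item sizes, including those of the items already in the open bins of b, are rational numbers. -}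

module Defs where

open import Data.Nat using (ℕ)
open import Data.Rational using (ℚ; 0ℚ; 1ℚ; _+_; _≤_; _<_)
open import Data.List using (List; []; _∷_; foldr; length; concat; _++_)
open import Data.List.Relation.Unary.All using (All)
open import Data.Vec using (Vec; lookup; updateAt; _[_]≔_)
open import Data.Fin using (Fin)
open import Data.Product using (_×_)

Item : Set
Item = ℚ

-- A bin is the list of the sizes of the items it contains.
Bin : Set
Bin = List Item

load : Bin → ℚ
load = foldr _+_ 0ℚ

ValidItem : Item → Set
ValidItem s = (0ℚ < s) × (s ≤ 1ℚ)

ValidBin : Bin → Set
ValidBin B = All ValidItem B × (load B ≤ 1ℚ)

Packing : Set
Packing = List Bin

ValidPacking : Packing → Set
ValidPacking P = All ValidBin P

record State (k : ℕ) : Set where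
  constructor st
  field
    open′  : Vec Bin k
    closed : List Bin
open State public

binsUsed : ∀ {k} → State k → ℕ
binsUsed {k} σ = length (closed σ) Data.Nat.+ k

-- One step of Bounded Best-Fit on an item of size s
-- (a relation, since ties are broken arbitrarily).
data BBFStep {k : ℕ} : State k → Item → State k → Set where
  fit : ∀ {o c s} (i : Fin k) →
        load (lookup o i) + s ≤ 1ℚ →
        (∀ (j : Fin k) → load (lookup o j) + s ≤ 1ℚ → load (lookup o j) ≤ load (lookup o i)) →
        BBFStep (st o c) s (st (updateAt o i (s ∷_)) c)
  open-new : ∀ {o c s} (i : Fin k) →
        (∀ (j : Fin k) → 1ℚ < load (lookup o j) + s) →
        (∀ (j : Fin k) → load (lookup o j) ≤ load (lookup o i)) →
        BBFStep (st o c) s (st (o [ i ]≔ (s ∷ [])) (c ++ (lookup o i ∷ [])))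

data BBFRun {k : ℕ} : State k → List Item → State k → Set where
  done : ∀ {σ} → BBFRun σ [] σ
  step : ∀ {σ σ′ σ″ s xs} → BBFStep σ s σ′ → BBFRun σ′ xs σ″ → BBFRun σ (s ∷ xs) σ″

itemsInOrder : Packing → List Item
itemsInOrder = concat

module Submission where

-- Cut the item sequence of P at the boundaries of its bins and
-- look at the run of Bounded Best-Fit on the items of a single bin B of P.
-- If the run never opens a new bin, it closes nothing.  Otherwise, right after
-- the first opening the fresh open bin contains only the first item of B, so it
-- can absorb every remaining item of B (their total is at most 1 because B is a
-- unit bin).  While such an open bin exists no opening can happen: a bin with
-- room for all remaining items certainly has room for the next one, and
-- Best-Fit only increases the load of that bin by the item it packs.  Hence the
-- items of one bin of P cause at most one bin to be closed, so the whole run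
-- closes at most |P| bins, and together with the k open bins BBF uses at most
-- k + |P| bins.

open import Defs
open import Data.Nat using (ℕ; _≤_; _+_)
open import Data.Vec using (Vec)
open import Data.Vec.Relation.Unary.All using (All)
open import Data.List using (List; []; length)

import Data.Nat as ℕ
import Data.Nat.Properties as ℕP
import Data.Rational as ℚ
open ℚ using (0ℚ; 1ℚ)
import Data.Rational.Properties as ℚP
open import Data.List using (_∷_; _++_)
open import Data.List.Properties using (length-++)
import Data.List.Relation.Unary.All as List
open import Data.Vec using (lookup; updateAt; _[_]≔_)
open import Data.Vec.Properties using (lookup∘updateAt; lookup∘updateAt′; lookup∘update)
open import Data.Fin using (Fin) renaming (_≟_ to _≟ᶠ_)
open import Data.Product using (Σ; _×_; _,_)
open import Data.Empty using (⊥-elim)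
open import Relation.Nullary using (yes; no)
open import Relation.Binary.PropositionalEquality

-- Lists of nonnegative item sizes; all load estimates below only need this.
NonNeg : List Item → Set
NonNeg = List.All (0ℚ ℚ.≤_)

valid⇒nonNeg : ∀ {B} → List.All ValidItem B → NonNeg B
valid⇒nonNeg = List.map (λ { (0<s , _) → ℚP.<⇒≤ 0<s })

load-nonNeg : ∀ R → NonNeg R → 0ℚ ℚ.≤ load R
load-nonNeg []      _                   = ℚP.≤-refl
load-nonNeg (s ∷ R) (0≤s List.∷ nn) = ℚP.+-mono-≤ 0≤s (load-nonNeg R nn)

≤-+-nonNeg : ∀ a {b} → 0ℚ ℚ.≤ b → a ℚ.≤ a ℚ.+ b
≤-+-nonNeg a {b} 0≤b = subst (ℚ._≤ a ℚ.+ b) (ℚP.+-identityʳ a) (ℚP.+-monoʳ-≤ a 0≤b)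

load-after-pack : ∀ {k} (o : Vec Bin k) (i j : Fin k) {s} → 0ℚ ℚ.≤ s →
                  load (lookup (updateAt o j (s ∷_)) i) ℚ.≤ load (lookup o i) ℚ.+ s
load-after-pack o i j {s} 0≤s with i ≟ᶠ j
... | yes refl = ℚP.≤-reflexive (begin
        load (lookup (updateAt o i (s ∷_)) i) ≡⟨ cong load (lookup∘updateAt i o) ⟩
        s ℚ.+ load (lookup o i)               ≡⟨ ℚP.+-comm s _ ⟩
        load (lookup o i) ℚ.+ s               ∎)
  where open ≡-Reasoning
... | no i≢j = subst (ℚ._≤ load (lookup o i) ℚ.+ s)
                 (sym (cong load (lookup∘updateAt′ i j i≢j o)))
                 (≤-+-nonNeg (load (lookup o i)) 0≤s)

run-split : ∀ {k} xs ys {σ τ : State k} → BBFRun σ (xs ++ ys) τ →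
            Σ (State k) λ ρ → BBFRun σ xs ρ × BBFRun ρ ys τ
run-split []       ys run = _ , done , run
run-split (x ∷ xs) ys (step s run) with run-split xs ys run
... | ρ , run₁ , run₂ = ρ , step s run₁ , run₂

-- As long as some open bin i can absorb all remaining items R, Best-Fit never
-- opens a new bin, so no bin gets closed.
run-closes-nothing : ∀ {k} R (o : Vec Bin k) c (i : Fin k) {τ} →
                     load (lookup o i) ℚ.+ load R ℚ.≤ 1ℚ → NonNeg R →
                     BBFRun (st o c) R τ → closed τ ≡ c
run-closes-nothing [] o c i room nn done = refl
run-closes-nothing (s ∷ R) o c i room (0≤s List.∷ nn) (step (fit j _ _) run) =
  run-closes-nothing R (updateAt o j (s ∷_)) c i room′ nn run
  where
  open ℚP.≤-Reasoning
  -- bin i, now holding at most s more, still has room for the rest R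
  room′ : load (lookup (updateAt o j (s ∷_)) i) ℚ.+ load R ℚ.≤ 1ℚ
  room′ = begin
    load (lookup (updateAt o j (s ∷_)) i) ℚ.+ load R
      ≤⟨ ℚP.+-monoˡ-≤ (load R) (load-after-pack o i j 0≤s) ⟩
    (load (lookup o i) ℚ.+ s) ℚ.+ load R
      ≡⟨ ℚP.+-assoc (load (lookup o i)) s (load R) ⟩
    load (lookup o i) ℚ.+ (s ℚ.+ load R)
      ≤⟨ room ⟩
    1ℚ ∎
run-closes-nothing (s ∷ R) o c i room (0≤s List.∷ nn) (step (open-new _ noRoom _) run) =
  ⊥-elim (ℚP.<-irrefl refl 1<1)
  where
  open ℚP.≤-Reasoning
  -- bin i has room for s, contradicting that no open bin has room
  1<1 : 1ℚ ℚ.< 1ℚ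
  1<1 = begin-strict
    1ℚ                                     <⟨ noRoom i ⟩
    load (lookup o i) ℚ.+ s                ≤⟨ ≤-+-nonNeg _ (load-nonNeg R nn) ⟩
    (load (lookup o i) ℚ.+ s) ℚ.+ load R   ≡⟨ ℚP.+-assoc (load (lookup o i)) s (load R) ⟩
    load (lookup o i) ℚ.+ (s ℚ.+ load R)   ≤⟨ room ⟩
    1ℚ                                     ∎

-- The items of one unit bin R cause at most one bin to be closed: up to the
-- first opening nothing is closed, and the freshly opened bin holding the item
-- s can absorb the rest of R, so afterwards nothing is closed either.
run-closes-at-most-one : ∀ {k} R (o : Vec Bin k) c {τ} →
                         load R ℚ.≤ 1ℚ → NonNeg R →
                         BBFRun (st o c) R τ → length (closed τ) ≤ ℕ.suc (length c)
run-closes-at-most-one [] o c fits nn done = ℕP.n≤1+n _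
run-closes-at-most-one (s ∷ R) o c fits (0≤s List.∷ nn) (step (fit j _ _) run) =
  run-closes-at-most-one R _ c (ℚP.≤-trans rest≤all fits) nn run
  where
  rest≤all : load R ℚ.≤ s ℚ.+ load R
  rest≤all = subst (load R ℚ.≤_) (ℚP.+-comm (load R) s) (≤-+-nonNeg (load R) 0≤s)
run-closes-at-most-one (s ∷ R) o c {τ} fits (0≤s List.∷ nn) (step (open-new i _ _) run) =
  ℕP.≤-reflexive (begin
    length (closed τ)      ≡⟨ cong length (run-closes-nothing R _ _ i room nn run) ⟩
    length (c ++ _ ∷ [])   ≡⟨ length-++ c ⟩
    length c + 1           ≡⟨ ℕP.+-comm (length c) 1 ⟩
    ℕ.suc (length c)       ∎)
  where
  open ≡-Reasoning
  -- the new bin i contains just s, and s together with R fits in a unit bin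
  room : load (lookup (o [ i ]≔ (s ∷ [])) i) ℚ.+ load R ℚ.≤ 1ℚ
  room rewrite lookup∘update i o (s ∷ []) | ℚP.+-identityʳ s = fits

closed-bound : ∀ {k} (P : Packing) (o : Vec Bin k) c {τ} → ValidPacking P →
               BBFRun (st o c) (itemsInOrder P) τ → length (closed τ) ≤ length c + length P
closed-bound []      o c valid done = ℕP.m≤m+n _ 0
closed-bound (B ∷ P) o c {τ} ((items , fits) List.∷ valid) run
  with run-split B (itemsInOrder P) run
... | st o′ c′ , runB , runP = begin
  length (closed τ)           ≤⟨ closed-bound P o′ c′ valid runP ⟩
  length c′ + length P        ≤⟨ ℕP.+-monoˡ-≤ (length P)
                                   (run-closes-at-most-one B o c fits (valid⇒nonNeg items) runB) ⟩
  ℕ.suc (length c) + length P ≡⟨ ℕP.+-suc (length c) (length P) ⟨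
  length c + ℕ.suc (length P) ∎
  where open ℕP.≤-Reasoning

lemma1 : (k : ℕ) → 1 ≤ k → (b : Vec Bin k) → All ValidBin b →
         (P : Packing) → ValidPacking P →
         (σ : State k) → BBFRun (st b []) (itemsInOrder P) σ →
         binsUsed σ ≤ k + length P
lemma1 k _ b _ P valid σ run = begin
  length (closed σ) + k ≤⟨ ℕP.+-monoˡ-≤ k (closed-bound P b [] valid run) ⟩
  length P + k          ≡⟨ ℕP.+-comm (length P) k ⟩
  k + length P          ∎
  where open ℕP.≤-Reasoning
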